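{- Let $\mathbb{F}_q$ be a finite field of odd characteristic, let $n\ge1$, and let $A\in\mathbb{F}_q^{n\times n}$ be a uniformly random matrix. For $0\le s\le n$ let $A^{\uparrow s}$ be the $(n-s)\times n$ submatrix of $A$ obtained by deleting the last $s$ rows, and let $\mathcal{E}(s)$ be the event that $A^{\uparrow s}$ contains an $(n-s)\times(n-s)$ submatrix with nonzero permanent. Then for any $s\in\{1,\dots,n\}$ and any outcome of $A^{\uparrow s}$ for which $\mathcal{E}(s)$ holds, we have \[\Pr[\mathcal{E}(s-1)\mid A^{\uparrow s}]\ge 1-q^{ -s}.\]
   Context: The permanent of a $k\times k$ matrix $B=(b_{i,j})$ is $\sum_{\pi\in S_k}\prod_{i=1}^k b_{i,\pi(i)}$; the empty ($0\times 0$) matrix has permanent $1$. -}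

module Defs where

open import Level using (Level; _⊔_) renaming (suc to lsuc)
open import Algebra.Bundles using (CommutativeRing)
open import Data.Nat using (ℕ; zero; suc)
open import Data.Fin as Fin using (Fin; zero; suc)
open import Data.Fin.Properties using (all?)
import Data.Fin.Properties as FinP
open import Data.List using (List; []; _∷_; [_]; map; concatMap; filter; foldr; length; allFin)
open import Data.List.Relation.Unary.Any using (Any)
open import Data.List.Relation.Unary.AllPairs using (AllPairs)
import Data.Vec.Functional as VF
open import Data.Product using (∃; _×_)
open import Relation.Nullary using (¬_; Dec)
open import Relation.Nullary.Decidable using (¬?; _→-dec_; _×-dec_)
open import Relation.Binary using (Decidable)
open import Relation.Binary.PropositionalEquality using (_≡_)

record FiniteField (c ℓ : Level) : Set (lsuc (c ⊔ ℓ)) where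
  field
    commRing : CommutativeRing c ℓ
  open CommutativeRing commRing public hiding (ring)
  field
    1≉0      : ¬ (1# ≈ 0#)
    inverse  : ∀ x → ¬ (x ≈ 0#) → ∃ λ y → x * y ≈ 1#
    _≟_      : Decidable _≈_
    elements : List Carrier
    complete : ∀ x → Any (x ≈_) elements
    distinct : AllPairs (λ x y → ¬ (x ≈ y)) elements

  size : ℕ
  size = length elements

allFuns : ∀ {b} {B : Set b} (k : ℕ) → List B → List (Fin k → B)
allFuns zero    xs = [ (λ ()) ]
allFuns (suc k) xs = concatMap (λ x → map (λ f → x VF.∷ f) (allFuns k xs)) xs

Injective? : ∀ {k m} (π : Fin k → Fin m) → Dec (∀ i j → π i ≡ π j → i ≡ j)
Injective? π = all? (λ i → all? (λ j → (π i Fin.≟ π j) →-dec (i Fin.≟ j)))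

perms : (k : ℕ) → List (Fin k → Fin k)
perms k = filter Injective? (allFuns k (allFin k))

StrictlyIncreasing : ∀ {k n} → (Fin k → Fin n) → Set
StrictlyIncreasing ρ = ∀ i j → i Fin.< j → ρ i Fin.< ρ j

StrictlyIncreasing? : ∀ {k n} (ρ : Fin k → Fin n) → Dec (StrictlyIncreasing ρ)
StrictlyIncreasing? ρ = all? (λ i → all? (λ j → (i Fin.<? j) →-dec (ρ i Fin.<? ρ j)))

module _ {c ℓ} (F : FiniteField c ℓ) where
  open FiniteField F using (Carrier; _≈_; _+_; _*_; 0#; 1#; _≟_; elements)

  prodFin : ∀ k → (Fin k → Carrier) → Carrier
  prodFin zero    f = 1#
  prodFin (suc k) f = f zero * prodFin k (λ i → f (suc i))

  -- permanent: Σ_{π ∈ S_k} Π_i b_{i,π(i)}  (empty matrix has permanent 1)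
  perm : ∀ k → (Fin k → Fin k → Carrier) → Carrier
  perm k B = foldr (λ π acc → prodFin k (λ i → B i (π i)) + acc) 0# (perms k)

  GoodCols : ∀ {k n} → (Fin k → Fin n → Carrier) → (Fin k → Fin n) → Set ℓ
  GoodCols {k} M ρ = StrictlyIncreasing ρ × ¬ (perm k (λ i j → M i (ρ j)) ≈ 0#)

  GoodCols? : ∀ {k n} (M : Fin k → Fin n → Carrier) → ∀ ρ → Dec (GoodCols M ρ)
  GoodCols? {k} M ρ = StrictlyIncreasing? ρ ×-dec ¬? (perm k (λ i j → M i (ρ j)) ≟ 0#)

  HasNonzeroPermMinor : ∀ {k n} → (Fin k → Fin n → Carrier) → Set ℓ
  HasNonzeroPermMinor {k} {n} M = Any (GoodCols M) (allFuns k (allFin n))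

  HasNonzeroPermMinor? : ∀ {k n} (M : Fin k → Fin n → Carrier) → Dec (HasNonzeroPermMinor M)
  HasNonzeroPermMinor? {k} {n} M = Data.List.Relation.Unary.Any.any? (GoodCols? M) (allFuns k (allFin n))
    where import Data.List.Relation.Unary.Any

  appendRow : ∀ {k n} → (Fin k → Fin n → Carrier) → (Fin n → Carrier) → Fin (suc k) → Fin n → Carrier
  appendRow {zero}  M r zero    = r
  appendRow {suc k} M r zero    = M zero
  appendRow {suc k} M r (suc i) = appendRow (λ i' → M (suc i')) r i

  allRows : ∀ n → List (Fin n → Carrier)
  allRows n = allFuns n elements

  goodRowCount : ∀ {k n} → (Fin k → Fin n → Carrier) → ℕ
  goodRowCount {k} {n} M = length (filter (λ r → HasNonzeroPermMinor? (appendRow M r)) (allRows n))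

-- Let ρ be k = n − s columns on which M has nonzero permanent, and call a row r bad if M with r
-- appended has no nonzero maximal permanent minor. For a column c outside ρ, expanding the
-- permanent on the columns ρ ∪ {c} along the new row gives a linear form in r whose coefficient
-- at r c is the permanent on ρ; since it vanishes for a bad r, the entry r c is determined by
-- r ∘ ρ. Hence there are at most q^k bad rows among all q^n, and the good ones number at least
-- q^n − q^(n−s), which is the claim after multiplying by q^s.
module Submission where

open import Level using (Level)
open import Algebra.Bundles using (Semiring)
open import Data.Bool using (if_then_else_)
open import Data.Nat using (ℕ; zero; suc; z≤n; s≤s)
open import Data.Fin as Fin using (Fin; zero; suc; punchIn; fromℕ)
import Data.Fin.Properties as Fin
open import Data.Vec.Functional as Vector using (Vector; insertAt)
open import Data.Vec.Functional.Properties using (∷-cong; insertAt-lookup; insertAt-punchIn)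
open import Data.Product using (∃; _×_; _,_)
open import Data.Sum using (_⊎_; inj₁; inj₂)
open import Function using (id; _∘_; _$_; _⇔_; mk⇔; Equivalence)
open import Relation.Binary using (tri<; tri≈; tri>)
open import Relation.Nullary using (¬_; Dec; yes; no; does; ¬?; contradiction; _×-dec_)
open import Relation.Binary.PropositionalEquality as ≡ using (_≡_; _≢_; _≗_)

open import Defs

private variable
  a b p r : Level
  A : Set a
  B : Set b

module Counting where

  open import Data.Nat using (_+_; _*_; _^_; _∸_; _≤_)
  import Data.Nat.Properties as ℕ
  open import Data.List as List using (List; []; _∷_; concatMap; filter; length)
  import Data.List.Properties as List
  open import Data.List.Relation.Unary.Any as Any using (Any; here; there; _─_)
  import Data.List.Relation.Unary.Any.Properties as Any
  open import Data.List.Relation.Unary.All as All using (All; []; _∷_)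
  import Data.List.Relation.Unary.All.Properties as All
  open import Data.List.Relation.Unary.AllPairs as AllPairs using (AllPairs; []; _∷_)
  import Data.List.Relation.Unary.AllPairs.Properties as AllPairs
  open import Data.Empty using (⊥; ⊥-elim)

  length-concatMap-const : ∀ (f : A → List B) {c} → (∀ x → length (f x) ≡ c) →
                           ∀ xs → length (concatMap f xs) ≡ length xs * c
  length-concatMap-const f same []       = ≡.refl
  length-concatMap-const f same (x ∷ xs) = ≡.trans (List.length-++ (f x))
    (≡.cong₂ _+_ (same x) (length-concatMap-const f same xs))

  length-filter-+-length-filter-¬ : {P : A → Set p} (P? : ∀ x → Dec (P x)) (xs : List A) →
    length (filter P? xs) + length (filter (¬? ∘ P?) xs) ≡ length xs
  length-filter-+-length-filter-¬ P? []       = ≡.refl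
  length-filter-+-length-filter-¬ P? (x ∷ xs) with P? x
  ... | yes _ = ≡.cong suc (length-filter-+-length-filter-¬ P? xs)
  ... | no  _ = ≡.trans (ℕ.+-suc _ _) (≡.cong suc (length-filter-+-length-filter-¬ P? xs))

  any-─ : {P Q : A → Set p} {ys : List A} (removed : Any P ys) → Any Q ys →
          (∀ {y} → P y → Q y → ⊥) → Any Q (ys ─ removed)
  any-─ (here  py) (here  qy) disjoint = ⊥-elim (disjoint py qy)
  any-─ (here  py) (there qy) disjoint = qy
  any-─ (there _)  (here  qy) disjoint = here qy
  any-─ (there a)  (there qy) disjoint = there (any-─ a qy disjoint)

  pigeonhole : (S : A → B → Set r) {xs : List A} {ys : List B} →
               AllPairs (λ x x′ → ∀ {y} → S x y → S x′ y → ⊥) xs →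
               All (λ x → Any (S x) ys) xs → length xs ≤ length ys
  pigeonhole S []                      []               = z≤n
  pigeonhole S {ys = ys} (unshared ∷ rest) (match ∷ matches) = ℕ.≤-trans
    (s≤s (pigeonhole S rest (All.zipWith (λ (u , m) → any-─ match m (λ {y} → u {y})) (unshared , matches))))
    (ℕ.≤-reflexive (≡.sym (List.length-removeAt′ ys (Any.index match))))

  module _ {R : A → B → Set r} where

    allFuns-complete : ∀ k {xs : List B} (f : Fin k → A) → (∀ i → Any (R (f i)) xs) →
                       Any (λ g → ∀ i → R (f i) (g i)) (allFuns k xs)
    allFuns-complete zero    f covered = here (λ ())
    allFuns-complete (suc k) f covered =
      Any.concat⁺ (Any.map⁺ (Any.map (λ Rx → Any.map⁺ (Any.map (λ Rg → λ { zero → Rx ; (suc i) → Rg i }) tails))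
                                      (covered zero)))
      where tails = allFuns-complete k (f ∘ suc) (covered ∘ suc)

  module _ {R : B → B → Set r} where

    allFuns-distinct : ∀ k {xs : List B} → AllPairs (λ x y → ¬ R x y) xs →
                       AllPairs (λ f g → ¬ (∀ i → R (f i) (g i))) (allFuns k xs)
    allFuns-distinct zero    distinct = [] ∷ []
    allFuns-distinct (suc k) {xs} distinct = AllPairs.concat⁺
      (All.map⁺ (All.universal (λ _ → AllPairs.map⁺ (AllPairs.map (λ differ same → differ (same ∘ suc)) tails)) xs))
      (AllPairs.map⁺ (AllPairs.map (λ x≉y → All.map⁺ (All.universal (λ _ →
        All.map⁺ (All.universal (λ _ same → x≉y (same zero)) _)) _)) distinct))
      where tails = allFuns-distinct k distinct

  length-allFuns : ∀ k (xs : List B) → length (allFuns k xs) ≡ length xs ^ k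
  length-allFuns zero    xs = ≡.refl
  length-allFuns (suc k) xs =
    length-concatMap-const _ (λ x → ≡.trans (List.length-map (x Vector.∷_) (allFuns k xs)) (length-allFuns k xs)) xs

  counting-bound : ∀ q n s G L → s ≤ n → G + L ≡ q ^ n → L ≤ q ^ (n ∸ s) → (q ^ s ∸ 1) * q ^ n ≤ q ^ s * G
  counting-bound q n s G L s≤n G+L≡qⁿ L≤qⁿ⁻ˢ = begin
    (q ^ s ∸ 1) * q ^ n                 ≡⟨ ℕ.*-distribʳ-∸ (q ^ n) (q ^ s) 1 ⟩
    q ^ s * q ^ n ∸ 1 * q ^ n           ≡⟨ ≡.cong₂ _∸_ (≡.cong (q ^ s *_) (≡.sym G+L≡qⁿ)) (ℕ.*-identityˡ (q ^ n)) ⟩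
    q ^ s * (G + L) ∸ q ^ n             ≡⟨ ≡.cong (_∸ q ^ n) (ℕ.*-distribˡ-+ (q ^ s) G L) ⟩
    q ^ s * G + q ^ s * L ∸ q ^ n       ≤⟨ ℕ.∸-monoʳ-≤ (q ^ s * G + q ^ s * L) qˢL≤qⁿ ⟩
    q ^ s * G + q ^ s * L ∸ q ^ s * L   ≡⟨ ℕ.m+n∸n≡m (q ^ s * G) (q ^ s * L) ⟩
    q ^ s * G                           ∎
    where
    open ℕ.≤-Reasoning
    qˢL≤qⁿ : q ^ s * L ≤ q ^ n
    qˢL≤qⁿ = ℕ.≤-trans (ℕ.*-monoʳ-≤ (q ^ s) L≤qⁿ⁻ˢ)
               (ℕ.≤-reflexive (≡.trans (≡.sym (ℕ.^-distribˡ-+-* q s (n ∸ s))) (≡.cong (q ^_) (ℕ.m+[n∸m]≡n s≤n))))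

insertAt⁺ : ∀ {n} {P : A → Set p} (xs : Vector A n) (i : Fin (suc n)) {v : A} →
            P v → (∀ j → P (xs j)) → ∀ j → P (insertAt xs i v j)
insertAt⁺             xs zero    pv pxs zero    = pv
insertAt⁺             xs zero    pv pxs (suc j) = pxs j
insertAt⁺ {n = suc n} xs (suc i) pv pxs zero    = pxs zero
insertAt⁺ {n = suc n} {P = P} xs (suc i) pv pxs (suc j) = insertAt⁺ {P = P} (Vector.tail xs) i pv (pxs ∘ suc) j

strictlyIncreasing-insertAt : ∀ {k n} (ρ : Fin k → Fin n) → StrictlyIncreasing ρ →
                              (c : Fin n) → (∀ i → ρ i ≢ c) →
                              ∃ λ p → StrictlyIncreasing (insertAt ρ p c)
strictlyIncreasing-insertAt {zero}  ρ ρ↑ c c∉ρ = zero , λ { zero zero () }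
strictlyIncreasing-insertAt {suc k} ρ ρ↑ c c∉ρ with Fin.<-cmp c (ρ zero)
... | tri≈ _ c≡ρ₀ _ = contradiction (≡.sym c≡ρ₀) (c∉ρ zero)
... | tri< c<ρ₀ _ _ = zero , τ↑
  where
  τ↑ : StrictlyIncreasing (insertAt ρ zero c)
  τ↑ zero    zero          ()
  τ↑ zero    (suc zero)    _        = c<ρ₀
  τ↑ zero    (suc (suc j)) _        = Fin.<-trans c<ρ₀ (ρ↑ zero (suc j) (s≤s z≤n))
  τ↑ (suc i) (suc j)       (s≤s i<j) = ρ↑ i j i<j
... | tri> _ _ ρ₀<c
  with p , τ′↑ ← strictlyIncreasing-insertAt (Vector.tail ρ) (λ i j i<j → ρ↑ (suc i) (suc j) (s≤s i<j)) c (c∉ρ ∘ suc)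
  = suc p , τ↑
  where
  τ↑ : StrictlyIncreasing (insertAt ρ (suc p) c)
  τ↑ zero    zero    ()
  τ↑ zero    (suc j) _         =
    insertAt⁺ {P = ρ zero Fin.<_} (Vector.tail ρ) p ρ₀<c (λ j → ρ↑ zero (suc j) (s≤s z≤n)) j
  τ↑ (suc i) (suc j) (s≤s i<j) = τ′↑ i j i<j

Avoids : ∀ {k m} → (Fin k → Fin m) → Fin m → Set
Avoids f x = ∀ i → f i ≢ x

avoids? : ∀ {k m} (f : Fin k → Fin m) x → Dec (Avoids f x)
avoids? f x = Fin.all? (λ i → ¬? (f i Fin.≟ x))

Injective : ∀ {k m} → (Fin k → Fin m) → Set
Injective f = ∀ i j → f i ≡ f j → i ≡ j

≡-or-punchIn : ∀ {k} (p i : Fin (suc k)) → i ≡ p ⊎ ∃ λ i′ → punchIn p i′ ≡ i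
≡-or-punchIn p i with i Fin.≟ p
... | yes i≡p = inj₁ i≡p
... | no  i≢p = inj₂ (_ , Fin.punchIn-punchOut (i≢p ∘ ≡.sym))

injective-insertAt : ∀ {k m} (f : Fin k → Fin m) p x → Injective (insertAt f p x) ⇔ (Avoids f x × Injective f)
injective-insertAt f p x = mk⇔ to from
  where
  g = insertAt f p x

  g-p : g p ≡ x
  g-p = insertAt-lookup f p x

  g-punchIn : ∀ i → g (punchIn p i) ≡ f i
  g-punchIn = insertAt-punchIn f p x

  to : Injective g → Avoids f x × Injective f
  to g-inj =
      (λ i fi≡x → Fin.punchInᵢ≢i p i (g-inj _ _ (≡.trans (g-punchIn i) (≡.trans fi≡x (≡.sym g-p)))))
    , (λ i j fi≡fj → Fin.punchIn-injective p i j
                       (g-inj _ _ (≡.trans (g-punchIn i) (≡.trans fi≡fj (≡.sym (g-punchIn j))))))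

  from : Avoids f x × Injective f → Injective g
  from (f-avoids , f-inj) i j gi≡gj with ≡-or-punchIn p i | ≡-or-punchIn p j
  ... | inj₁ ≡.refl        | inj₁ ≡.refl        = ≡.refl
  ... | inj₁ ≡.refl        | inj₂ (j′ , ≡.refl) =
    contradiction (≡.trans (≡.sym (g-punchIn j′)) (≡.trans (≡.sym gi≡gj) g-p)) (f-avoids j′)
  ... | inj₂ (i′ , ≡.refl) | inj₁ ≡.refl        =
    contradiction (≡.trans (≡.sym (g-punchIn i′)) (≡.trans gi≡gj g-p)) (f-avoids i′)
  ... | inj₂ (i′ , ≡.refl) | inj₂ (j′ , ≡.refl) =
    ≡.cong (punchIn p) (f-inj i′ j′ (≡.trans (≡.sym (g-punchIn i′)) (≡.trans gi≡gj (g-punchIn j′))))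

module FunctionSum {c ℓ} (R : Semiring c ℓ) where

  open Semiring R hiding (zero)
  open import Algebra.Properties.Semiring.Sum R
    using (sum; sum-syntax; sum-cong-≋; sum-remove; sum-replicate-zero; ∑-comm; *-distribˡ-sum)
  open import Relation.Binary.Reasoning.Setoid setoid
  open import Data.List as List using (List; []; _∷_; _++_; concatMap; filter)

  ∑-cong : ∀ n {f g : Vector Carrier n} → (∀ i → f i ≈ g i) → sum f ≈ sum g
  ∑-cong n = sum-cong-≋

  keepIf : ∀ {q} {Q : Set q} → Dec Q → Carrier → Carrier
  keepIf d x = if does d then x else 0#

  keepIf-cong : ∀ {q q′} {Q : Set q} {Q′ : Set q′} → Q ⇔ Q′ → (d : Dec Q) (d′ : Dec Q′) →
                ∀ {x y} → x ≈ y → keepIf d x ≈ keepIf d′ y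
  keepIf-cong Q⇔Q′ (yes _)  (yes _)   x≈y = x≈y
  keepIf-cong Q⇔Q′ (yes q)  (no ¬q′)  x≈y = contradiction (Equivalence.to Q⇔Q′ q) ¬q′
  keepIf-cong Q⇔Q′ (no ¬q)  (yes q′)  x≈y = contradiction (Equivalence.from Q⇔Q′ q′) ¬q
  keepIf-cong Q⇔Q′ (no _)   (no _)    x≈y = refl

  keepIf-yes : ∀ {q} {Q : Set q} (d : Dec Q) → Q → ∀ x → keepIf d x ≈ x
  keepIf-yes (yes _) q  x = refl
  keepIf-yes (no ¬q) q  x = contradiction q ¬q

  keepIf-no : ∀ {q} {Q : Set q} (d : Dec Q) → ¬ Q → ∀ x → keepIf d x ≈ 0#
  keepIf-no (yes q) ¬q x = contradiction q ¬q
  keepIf-no (no _)  ¬q x = refl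

  keepIf-× : ∀ {q q′} {Q : Set q} {Q′ : Set q′} (d : Dec Q) (d′ : Dec Q′) x →
             keepIf (d ×-dec d′) x ≈ keepIf d (keepIf d′ x)
  keepIf-× (yes _) (yes _) x = refl
  keepIf-× (yes _) (no _)  x = refl
  keepIf-× (no _)  _       x = refl

  keepIf-*ˡ : ∀ {q} {Q : Set q} (d : Dec Q) x y → keepIf d (x * y) ≈ x * keepIf d y
  keepIf-*ˡ (yes _) x y = refl
  keepIf-*ˡ (no _)  x y = sym (zeroʳ x)

  ∑ᶠ : ∀ k {m} → ((Fin k → Fin m) → Carrier) → Carrier
  ∑ᶠ zero        h = h (λ ())
  ∑ᶠ (suc k) {m} h = ∑[ x < m ] ∑ᶠ k (λ f → h (x Vector.∷ f))

  Extensional : ∀ {k m} → ((Fin k → Fin m) → Carrier) → Set ℓ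
  Extensional h = ∀ {f g} → f ≗ g → h f ≈ h g

  ∷-extensional : ∀ {k m} {h : (Fin (suc k) → Fin m) → Carrier} → Extensional h →
                  ∀ x → Extensional (λ f → h (x Vector.∷ f))
  ∷-extensional h-ext x f≗g = h-ext λ { zero → ≡.refl ; (suc i) → f≗g i }

  ∑ᶠ-cong : ∀ k {m} {g h : (Fin k → Fin m) → Carrier} → (∀ f → g f ≈ h f) → ∑ᶠ k g ≈ ∑ᶠ k h
  ∑ᶠ-cong zero    g≈h = g≈h _
  ∑ᶠ-cong (suc k) {m} g≈h = ∑-cong m (λ x → ∑ᶠ-cong k (λ f → g≈h (x Vector.∷ f)))

  ∑ᶠ-zero : ∀ k {m} → ∑ᶠ k {m} (λ _ → 0#) ≈ 0#
  ∑ᶠ-zero zero        = refl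
  ∑ᶠ-zero (suc k) {m} = trans (∑-cong m (λ _ → ∑ᶠ-zero k)) (sum-replicate-zero m)

  ∑ᶠ-*ˡ : ∀ k {m} x (h : (Fin k → Fin m) → Carrier) → ∑ᶠ k (λ f → x * h f) ≈ x * ∑ᶠ k h
  ∑ᶠ-*ˡ zero    x h = refl
  ∑ᶠ-*ˡ (suc k) {m} x h =
    trans (∑-cong m (λ y → ∑ᶠ-*ˡ k x (λ f → h (y Vector.∷ f)))) (sym (*-distribˡ-sum {m} x _))

  ∑ᶠ-insertAt : ∀ k {m} (p : Fin (suc k)) {h : (Fin (suc k) → Fin m) → Carrier} → Extensional h →
                ∑ᶠ (suc k) h ≈ ∑[ x < m ] ∑ᶠ k (λ f → h (insertAt f p x))
  ∑ᶠ-insertAt k {m} zero h-ext = ∑-cong m (λ x → ∑ᶠ-cong k (λ f → h-ext (∷-cong ≡.refl (λ _ → ≡.refl))))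
  ∑ᶠ-insertAt (suc k) {m} (suc p) {h} h-ext = begin
    ∑[ y < m ] ∑ᶠ (suc k) (λ f → h (y Vector.∷ f))
      ≈⟨ ∑-cong m (λ y → ∑ᶠ-insertAt k p (∷-extensional h-ext y)) ⟩
    ∑[ y < m ] ∑[ x < m ] ∑ᶠ k (λ g → h (y Vector.∷ insertAt g p x))
      ≈⟨ ∑-comm (λ y x → ∑ᶠ k (λ g → h (y Vector.∷ insertAt g p x))) ⟩
    ∑[ x < m ] ∑[ y < m ] ∑ᶠ k (λ g → h (y Vector.∷ insertAt g p x))
      ≈⟨ ∑-cong m (λ x → ∑-cong m (λ y → ∑ᶠ-cong k (λ g → h-ext (∷-cong ≡.refl (λ _ → ≡.refl))))) ⟩
    ∑[ x < m ] ∑ᶠ (suc k) (λ f → h (insertAt f (suc p) x)) ∎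

  ∑ᶠ-avoids : ∀ k {m} (x : Fin (suc m)) {h : (Fin k → Fin (suc m)) → Carrier} → Extensional h →
              ∑ᶠ k (λ f → keepIf (avoids? f x) (h f)) ≈ ∑ᶠ k (λ σ → h (punchIn x ∘ σ))
  ∑ᶠ-avoids zero {m} x h-ext =
    trans (keepIf-yes (avoids? {zero} {suc m} (λ ()) x) (λ ()) _) (h-ext (λ ()))
  ∑ᶠ-avoids (suc k) {m} x {h} h-ext = begin
    ∑[ y < suc m ] ∑ᶠ k (λ f → keepIf (avoids? (y Vector.∷ f) x) (h (y Vector.∷ f)))
      ≈⟨ sum-remove {i = x} (λ y → ∑ᶠ k (λ f → keepIf (avoids? (y Vector.∷ f) x) (h (y Vector.∷ f)))) ⟩
    ∑ᶠ k (λ f → keepIf (avoids? (x Vector.∷ f) x) (h (x Vector.∷ f)))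
      + ∑[ y < m ] ∑ᶠ k (λ f → keepIf (avoids? (punchIn x y Vector.∷ f) x) (h (punchIn x y Vector.∷ f)))
      ≈⟨ +-cong (trans (∑ᶠ-cong k (λ f → keepIf-no (avoids? (x Vector.∷ f) x) (λ avoids → avoids zero ≡.refl) _))
                       (∑ᶠ-zero k))
                (∑-cong m (λ y → ∑ᶠ-cong k (λ f →
                  keepIf-cong (avoids-tail y f) (avoids? (punchIn x y Vector.∷ f) x) (avoids? f x) refl))) ⟩
    0# + ∑[ y < m ] ∑ᶠ k (λ f → keepIf (avoids? f x) (h (punchIn x y Vector.∷ f)))
      ≈⟨ +-identityˡ _ ⟩
    ∑[ y < m ] ∑ᶠ k (λ f → keepIf (avoids? f x) (h (punchIn x y Vector.∷ f)))
      ≈⟨ ∑-cong m (λ y → ∑ᶠ-avoids k x (∷-extensional h-ext (punchIn x y))) ⟩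
    ∑[ y < m ] ∑ᶠ k (λ σ → h (punchIn x y Vector.∷ (punchIn x ∘ σ)))
      ≈⟨ ∑-cong m (λ y → ∑ᶠ-cong k (λ σ → h-ext (∷-cong ≡.refl (λ _ → ≡.refl)))) ⟩
    ∑[ y < m ] ∑ᶠ k (λ σ → h (punchIn x ∘ (y Vector.∷ σ))) ∎
    where
    avoids-tail : ∀ y (f : Fin k → Fin (suc m)) → Avoids (punchIn x y Vector.∷ f) x ⇔ Avoids f x
    avoids-tail y f = mk⇔ (_∘ suc) (λ { avoids zero → Fin.punchInᵢ≢i x y ; avoids (suc i) → avoids i })

  ∑ˡ : List A → (A → Carrier) → Carrier
  ∑ˡ xs h = List.foldr (λ x acc → h x + acc) 0# xs

  ∑ˡ-cong : (xs : List A) {g h : A → Carrier} → (∀ x → g x ≈ h x) → ∑ˡ xs g ≈ ∑ˡ xs h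
  ∑ˡ-cong []       g≈h = refl
  ∑ˡ-cong (x ∷ xs) g≈h = +-cong (g≈h x) (∑ˡ-cong xs g≈h)

  ∑ˡ-filter : {P : A → Set p} (P? : ∀ x → Dec (P x)) (xs : List A) (h : A → Carrier) →
              ∑ˡ (filter P? xs) h ≈ ∑ˡ xs (λ x → keepIf (P? x) (h x))
  ∑ˡ-filter P? []       h = refl
  ∑ˡ-filter P? (x ∷ xs) h with P? x
  ... | yes _ = +-congˡ (∑ˡ-filter P? xs h)
  ... | no  _ = trans (∑ˡ-filter P? xs h) (sym (+-identityˡ _))

  ∑ˡ-++ : (xs ys : List A) (h : A → Carrier) → ∑ˡ (xs ++ ys) h ≈ ∑ˡ xs h + ∑ˡ ys h
  ∑ˡ-++ []       ys h = sym (+-identityˡ _)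
  ∑ˡ-++ (x ∷ xs) ys h = trans (+-congˡ (∑ˡ-++ xs ys h)) (sym (+-assoc _ _ _))

  ∑ˡ-concatMap : (g : A → List B) (xs : List A) (h : B → Carrier) →
                 ∑ˡ (concatMap g xs) h ≈ ∑ˡ xs (λ x → ∑ˡ (g x) h)
  ∑ˡ-concatMap g []       h = refl
  ∑ˡ-concatMap g (x ∷ xs) h = trans (∑ˡ-++ (g x) _ h) (+-congˡ (∑ˡ-concatMap g xs h))

  ∑ˡ-map : (φ : A → B) (xs : List A) (h : B → Carrier) → ∑ˡ (List.map φ xs) h ≡ ∑ˡ xs (h ∘ φ)
  ∑ˡ-map φ []       h = ≡.refl
  ∑ˡ-map φ (x ∷ xs) h = ≡.cong (h (φ x) +_) (∑ˡ-map φ xs h)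

  ∑ˡ-tabulate : ∀ m (f : Fin m → A) (h : A → Carrier) → ∑ˡ (List.tabulate f) h ≈ ∑[ x < m ] h (f x)
  ∑ˡ-tabulate zero    f h = refl
  ∑ˡ-tabulate (suc m) f h = +-congˡ (∑ˡ-tabulate m (f ∘ suc) h)

  ∑ˡ-allFuns : ∀ k {m} {h : (Fin k → Fin m) → Carrier} → Extensional h →
               ∑ˡ (allFuns k (List.allFin m)) h ≈ ∑ᶠ k h
  ∑ˡ-allFuns zero        h-ext = trans (+-identityʳ _) (h-ext (λ ()))
  ∑ˡ-allFuns (suc k) {m} {h} h-ext = begin
    ∑ˡ (allFuns (suc k) (List.allFin m)) h
      ≈⟨ ∑ˡ-concatMap _ (List.allFin m) h ⟩
    ∑ˡ (List.allFin m) (λ x → ∑ˡ (List.map (x Vector.∷_) (allFuns k (List.allFin m))) h)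
      ≈⟨ ∑ˡ-cong (List.allFin m) (λ x → reflexive (∑ˡ-map (x Vector.∷_) (allFuns k (List.allFin m)) h)) ⟩
    ∑ˡ (List.allFin m) (λ x → ∑ˡ (allFuns k (List.allFin m)) (λ f → h (x Vector.∷ f)))
      ≈⟨ ∑ˡ-tabulate m (λ x → x) _ ⟩
    ∑[ x < m ] ∑ˡ (allFuns k (List.allFin m)) (λ f → h (x Vector.∷ f))
      ≈⟨ ∑-cong m (λ x → ∑ˡ-allFuns k (∷-extensional h-ext x)) ⟩
    ∑ᶠ (suc k) h ∎

module Permanent {c ℓ} (F : FiniteField c ℓ) where

  open FiniteField F hiding (zero)
  open FunctionSum semiring
  open import Algebra.Properties.Semiring.Sum semiring using (sum-syntax)
  open import Algebra.Properties.CommutativeMonoid.Sum *-commutativeMonoid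
    using () renaming (sum to product; sum-remove to product-remove)
  open import Relation.Binary.Reasoning.Setoid setoid
  open import Data.List using (allFin)
  open import Data.List.Relation.Unary.Any as Any using ()
  open import Data.List.Membership.Propositional.Properties using (∈-allFin)
  open Counting using (allFuns-complete)

  prodFin≡product : ∀ k (g : Fin k → Carrier) → prodFin F k g ≡ product g
  prodFin≡product zero    g = ≡.refl
  prodFin≡product (suc k) g = ≡.cong (g zero *_) (prodFin≡product k (g ∘ suc))

  prodFin-cong : ∀ k {g h : Fin k → Carrier} → (∀ i → g i ≈ h i) → prodFin F k g ≈ prodFin F k h
  prodFin-cong zero    g≈h = refl
  prodFin-cong (suc k) g≈h = *-cong (g≈h zero) (prodFin-cong k (g≈h ∘ suc))

  prodFin-punchIn : ∀ k (g : Fin (suc k) → Carrier) p → prodFin F (suc k) g ≈ g p * prodFin F k (g ∘ punchIn p)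
  prodFin-punchIn k g p = begin
    prodFin F (suc k) g              ≡⟨ prodFin≡product (suc k) g ⟩
    product g                        ≈⟨ product-remove {i = p} g ⟩
    g p * product (g ∘ punchIn p)    ≡⟨ ≡.cong (g p *_) (prodFin≡product k (g ∘ punchIn p)) ⟨
    g p * prodFin F k (g ∘ punchIn p) ∎

  permTerm : ∀ {k m} → (Fin k → Fin m → Carrier) → (Fin k → Fin m) → Carrier
  permTerm {k} B f = keepIf (Injective? f) (prodFin F k (λ i → B i (f i)))

  permTerm-extensional : ∀ {k m} (B : Fin k → Fin m → Carrier) → Extensional (permTerm B)
  permTerm-extensional {k} B {f} {g} f≗g =
    keepIf-cong (mk⇔ (transport f≗g) (transport (≡.sym ∘ f≗g))) (Injective? f) (Injective? g)
                (prodFin-cong k (λ i → reflexive (≡.cong (B i) (f≗g i))))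
    where
    transport : ∀ {f g : Fin k → Fin _} → f ≗ g → Injective f → Injective g
    transport f≗g f-inj i j gi≡gj = f-inj i j (≡.trans (f≗g i) (≡.trans gi≡gj (≡.sym (f≗g j))))

  perm≈∑ᶠ : ∀ {k} (B : Fin k → Fin k → Carrier) → perm F k B ≈ ∑ᶠ k (permTerm B)
  perm≈∑ᶠ {k} B = trans (∑ˡ-filter Injective? (allFuns k (allFin k)) _) (∑ˡ-allFuns k (permTerm-extensional B))

  perm-cong : ∀ {k} {B B′ : Fin k → Fin k → Carrier} → (∀ i j → B i j ≈ B′ i j) → perm F k B ≈ perm F k B′
  perm-cong {k} {B} {B′} B≈B′ = begin
    perm F k B          ≈⟨ perm≈∑ᶠ B ⟩
    ∑ᶠ k (permTerm B)   ≈⟨ ∑ᶠ-cong k (λ π → keepIf-cong (mk⇔ id id) (Injective? π) (Injective? π)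
                                                (prodFin-cong k (λ i → B≈B′ i (π i)))) ⟩
    ∑ᶠ k (permTerm B′)  ≈⟨ perm≈∑ᶠ B′ ⟨
    perm F k B′         ∎

  permTerm-insertAt : ∀ {k m} (B : Fin (suc k) → Fin m → Carrier) p x (f : Fin k → Fin m) →
    permTerm B (insertAt f p x) ≈ B p x * keepIf (avoids? f x) (permTerm (B ∘ punchIn p) f)
  permTerm-insertAt {k} B p x f = begin
    keepIf (Injective? g) (prodFin F (suc k) (λ i → B i (g i)))
      ≈⟨ keepIf-cong (injective-insertAt f p x) (Injective? g) (avoids? f x ×-dec Injective? f) (trans
           (prodFin-punchIn k (λ i → B i (g i)) p)
           (*-cong (reflexive (≡.cong (B p) (insertAt-lookup f p x)))
                   (prodFin-cong k (λ i → reflexive (≡.cong (B (punchIn p i)) (insertAt-punchIn f p x i)))))) ⟩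
    keepIf (avoids? f x ×-dec Injective? f) (B p x * prodFin F k (λ i → B (punchIn p i) (f i)))
      ≈⟨ keepIf-*ˡ (avoids? f x ×-dec Injective? f) _ _ ⟩
    B p x * keepIf (avoids? f x ×-dec Injective? f) (prodFin F k (λ i → B (punchIn p i) (f i)))
      ≈⟨ *-congˡ (keepIf-× (avoids? f x) (Injective? f) _) ⟩
    B p x * keepIf (avoids? f x) (permTerm (B ∘ punchIn p) f) ∎
    where g = insertAt f p x

  permTerm-punchIn : ∀ {k m} (B : Fin k → Fin (suc m) → Carrier) x (σ : Fin k → Fin m) →
    permTerm B (punchIn x ∘ σ) ≈ permTerm (λ i j → B i (punchIn x j)) σ
  permTerm-punchIn B x σ = keepIf-cong
    (mk⇔ (λ inj i j σi≡σj → inj i j (≡.cong (punchIn x) σi≡σj))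
         (λ inj i j xσi≡xσj → inj i j (Fin.punchIn-injective x _ _ xσi≡xσj)))
    (Injective? (punchIn x ∘ σ)) (Injective? σ) refl

  minor : ∀ {k} → (Fin (suc k) → Fin (suc k) → Carrier) → Fin (suc k) → Fin (suc k) → Fin k → Fin k → Carrier
  minor B p x i j = B (punchIn p i) (punchIn x j)

  perm-expand : ∀ k (B : Fin (suc k) → Fin (suc k) → Carrier) (p : Fin (suc k)) →
                perm F (suc k) B ≈ ∑[ x < suc k ] (B p x * perm F k (minor B p x))
  perm-expand k B p = begin
    perm F (suc k) B
      ≈⟨ perm≈∑ᶠ B ⟩
    ∑ᶠ (suc k) (permTerm B)
      ≈⟨ ∑ᶠ-insertAt k p (permTerm-extensional B) ⟩
    ∑[ x < suc k ] ∑ᶠ k (λ f → permTerm B (insertAt f p x))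
      ≈⟨ ∑-cong (suc k) (λ x → ∑ᶠ-cong k (permTerm-insertAt B p x)) ⟩
    ∑[ x < suc k ] ∑ᶠ k (λ f → B p x * keepIf (avoids? f x) (permTerm (B ∘ punchIn p) f))
      ≈⟨ ∑-cong (suc k) (λ x → ∑ᶠ-*ˡ k (B p x) (λ f → keepIf (avoids? f x) (permTerm (B ∘ punchIn p) f))) ⟩
    ∑[ x < suc k ] (B p x * ∑ᶠ k (λ f → keepIf (avoids? f x) (permTerm (B ∘ punchIn p) f)))
      ≈⟨ ∑-cong (suc k) (λ x → *-congˡ {B p x} (∑ᶠ-avoids k x (permTerm-extensional (B ∘ punchIn p)))) ⟩
    ∑[ x < suc k ] (B p x * ∑ᶠ k (λ σ → permTerm (B ∘ punchIn p) (punchIn x ∘ σ)))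
      ≈⟨ ∑-cong (suc k) (λ x → *-congˡ {B p x}
           (trans (∑ᶠ-cong k (permTerm-punchIn (B ∘ punchIn p) x)) (sym (perm≈∑ᶠ (minor B p x))))) ⟩
    ∑[ x < suc k ] (B p x * perm F k (minor B p x)) ∎

  appendRow≗insertAt : ∀ {k n} (M : Fin k → Fin n → Carrier) r → appendRow F M r ≗ insertAt M (fromℕ k) r
  appendRow≗insertAt {zero}  M r zero    = ≡.refl
  appendRow≗insertAt {suc k} M r zero    = ≡.refl
  appendRow≗insertAt {suc k} M r (suc i) = appendRow≗insertAt (M ∘ suc) r i

  perm-appendRow : ∀ {k n} (M : Fin k → Fin n → Carrier) r (τ : Fin (suc k) → Fin n) →
    perm F (suc k) (λ i j → appendRow F M r i (τ j))
      ≈ ∑[ x < suc k ] (r (τ x) * perm F k (λ i j → M i (τ (punchIn x j))))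
  perm-appendRow {k} M r τ =
    trans (perm-expand k (λ i j → appendRow F M r i (τ j)) (fromℕ k)) (∑-cong (suc k) (λ x →
      *-cong (reflexive (≡.cong (_$ τ x) (≡.trans (appendRow≗insertAt M r last) (insertAt-lookup M last r))))
             (perm-cong (λ i j → reflexive (≡.cong (_$ τ (punchIn x j))
               (≡.trans (appendRow≗insertAt M r (punchIn last i)) (insertAt-punchIn M last r i)))))))
    where last = fromℕ k

  goodCols-resp : ∀ {k n} {N : Fin k → Fin n → Carrier} {τ σ} → τ ≗ σ → GoodCols F N τ → GoodCols F N σ
  goodCols-resp {N = N} τ≗σ (τ↑ , perm≉0) =
      (λ i j i<j → ≡.subst₂ Fin._<_ (τ≗σ i) (τ≗σ j) (τ↑ i j i<j))
    , (λ perm≈0 → perm≉0 (trans (perm-cong (λ i j → reflexive (≡.cong (N i) (τ≗σ j)))) perm≈0))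

  hasNonzeroPermMinor : ∀ {k n} (N : Fin k → Fin n → Carrier) τ → GoodCols F N τ → HasNonzeroPermMinor F N
  hasNonzeroPermMinor {k} N τ good = Any.map (λ τ≗σ → goodCols-resp {N = N} τ≗σ good)
                                              (allFuns-complete {R = _≡_} k τ (λ i → ∈-allFin (τ i)))

module FieldProperties {c ℓ} (F : FiniteField c ℓ) where

  open FiniteField F
  open import Relation.Binary.Reasoning.Setoid setoid

  *-cancelʳ-≉0 : ∀ {x y z} → ¬ z ≈ 0# → x * z ≈ y * z → x ≈ y
  *-cancelʳ-≉0 {x} {y} {z} z≉0 xz≈yz with z⁻¹ , zz⁻¹≈1 ← inverse z z≉0 = begin
    x                ≈⟨ *-identityʳ x ⟨
    x * 1#           ≈⟨ *-congˡ zz⁻¹≈1 ⟨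
    x * (z * z⁻¹)    ≈⟨ *-assoc x z z⁻¹ ⟨
    (x * z) * z⁻¹    ≈⟨ *-congʳ xz≈yz ⟩
    (y * z) * z⁻¹    ≈⟨ *-assoc y z z⁻¹ ⟩
    y * (z * z⁻¹)    ≈⟨ *-congˡ zz⁻¹≈1 ⟩
    y * 1#           ≈⟨ *-identityʳ y ⟩
    y                ∎

module BadRows {c ℓ} (F : FiniteField c ℓ) {k n} (M : Fin k → Fin n → FiniteField.Carrier F)
               (ρ : Fin k → Fin n) (ρ↑ : StrictlyIncreasing ρ)
               (minor≉0 : ¬ FiniteField._≈_ F (perm F k (λ i j → M i (ρ j))) (FiniteField.0# F)) where

  open FiniteField F hiding (zero)
  open Permanent F
  open FieldProperties F
  open FunctionSum semiring using (∑-cong)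
  open Counting
  open import Algebra.Properties.Semiring.Sum semiring using (sum-syntax; sum-remove)
  open import Algebra.Properties.Group +-group using () renaming (∙-cancelʳ to +-cancelʳ)
  open import Relation.Binary.Reasoning.Setoid setoid
  open import Relation.Nullary.Decidable using (decidable-stable)
  open import Data.Nat as ℕ using (_^_; _≤_)
  open import Data.Empty using (⊥)
  import Data.Nat.Properties as ℕ
  open import Data.List using (List; filter; length)
  open import Data.List.Relation.Unary.Any as Any using (Any)
  open import Data.List.Relation.Unary.All as All using (All)
  import Data.List.Relation.Unary.All.Properties as All
  open import Data.List.Relation.Unary.AllPairs as AllPairs using (AllPairs)
  import Data.List.Relation.Unary.AllPairs.Properties as AllPairs

  goodRow? : (r : Fin n → Carrier) → Dec (HasNonzeroPermMinor F (appendRow F M r))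
  goodRow? r = HasNonzeroPermMinor? F (appendRow F M r)

  Bad : (Fin n → Carrier) → Set ℓ
  Bad r = ¬ HasNonzeroPermMinor F (appendRow F M r)

  perm-vanishes : ∀ {r} → Bad r → ∀ τ → StrictlyIncreasing τ →
                  perm F (suc k) (λ i j → appendRow F M r i (τ j)) ≈ 0#
  perm-vanishes {r} bad τ τ↑ = decidable-stable (perm F (suc k) (λ i j → appendRow F M r i (τ j)) ≟ 0#)
    (λ perm≉0 → bad (hasNonzeroPermMinor (appendRow F M r) τ (τ↑ , perm≉0)))

  bad-rows-agree : ∀ {r r′} → Bad r → Bad r′ → (∀ i → r (ρ i) ≈ r′ (ρ i)) → ∀ c → r c ≈ r′ c
  bad-rows-agree {r} {r′} bad bad′ agree c with Fin.any? (λ i → ρ i Fin.≟ c)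
  ... | yes (i , ρi≡c) = ≡.subst (λ c → r c ≈ r′ c) ρi≡c (agree i)
  ... | no c∉ρ with p , τ↑ ← strictlyIncreasing-insertAt ρ ρ↑ c (λ i ρi≡c → c∉ρ (i , ρi≡c)) =
    *-cancelʳ-≉0 (λ cof≈0 → minor≉0 (trans (sym cof-p) cof≈0))
      (+-cancelʳ _ _ _ (trans (expansion bad)
                             (trans (sym (expansion bad′)) (+-congˡ (∑-cong k (λ y → *-congʳ (sym (agree y))))))))
    where
    τ = insertAt ρ p c

    cof : Fin (suc k) → Carrier
    cof x = perm F k (λ i j → M i (τ (punchIn x j)))

    cof-p : cof p ≈ perm F k (λ i j → M i (ρ j))
    cof-p = perm-cong (λ i j → reflexive (≡.cong (M i) (insertAt-punchIn ρ p c j)))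

    expansion : ∀ {s} → Bad s → s c * cof p + ∑[ y < k ] (s (ρ y) * cof (punchIn p y)) ≈ 0#
    expansion {s} bad = begin
      s c * cof p + ∑[ y < k ] (s (ρ y) * cof (punchIn p y))
        ≈⟨ +-cong (*-congʳ (reflexive (≡.cong s (insertAt-lookup ρ p c))))
                  (∑-cong k (λ y → *-congʳ (reflexive (≡.cong s (insertAt-punchIn ρ p c y))))) ⟨
      s (τ p) * cof p + ∑[ y < k ] (s (τ (punchIn p y)) * cof (punchIn p y))
        ≈⟨ sum-remove {i = p} (λ x → s (τ x) * cof x) ⟨
      ∑[ x < suc k ] (s (τ x) * cof x)
        ≈⟨ perm-appendRow M s τ ⟨
      perm F (suc k) (λ i j → appendRow F M s i (τ j))
        ≈⟨ perm-vanishes bad τ τ↑ ⟩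
      0# ∎

  badRows : List (Fin n → Carrier)
  badRows = filter (¬? ∘ goodRow?) (allRows F n)

  goodRowCount+length-badRows : goodRowCount F M ℕ.+ length badRows ≡ size ^ n
  goodRowCount+length-badRows =
    ≡.trans (length-filter-+-length-filter-¬ goodRow? (allRows F n)) (length-allFuns n elements)

  length-badRows : length badRows ≤ size ^ k
  length-badRows =
    ℕ.≤-trans (pigeonhole BadAndRestrictsTo unshared covered) (ℕ.≤-reflexive (length-allFuns k elements))
    where
    BadAndRestrictsTo : (Fin n → Carrier) → (Fin k → Carrier) → Set ℓ
    BadAndRestrictsTo r g = Bad r × (∀ i → r (ρ i) ≈ g i)

    unshared : AllPairs (λ r r′ → ∀ {g} → BadAndRestrictsTo r g → BadAndRestrictsTo r′ g → ⊥) badRows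
    unshared = AllPairs.filter⁺ _ (AllPairs.map
      (λ r≉r′ {g} (bad , r≈g) (bad′ , r′≈g) → r≉r′ (bad-rows-agree bad bad′ (λ i → trans (r≈g i) (sym (r′≈g i)))))
      (allFuns-distinct n distinct))

    covered : All (λ r → Any (BadAndRestrictsTo r) (allFuns k elements)) badRows
    covered = All.map (λ {r} bad → Any.map (bad ,_) (allFuns-complete {R = _≈_} k (r ∘ ρ) (complete ∘ r ∘ ρ)))
                      (All.all-filter (¬? ∘ goodRow?) (allRows F n))

open import Data.Nat using (_≤_; _∸_; _*_; _^_)
open import Data.List using (length)
open import Data.List.Relation.Unary.Any using (satisfied)
open Counting using (counting-bound)
open FiniteField using (Carrier; _≈_; _+_; 1#; 0#; size)

lemma2p3 : ∀ {c ℓ} (F : FiniteField c ℓ) →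
    ¬ (_≈_ F (_+_ F (1# F) (1# F)) (0# F)) →
    ∀ (n s : ℕ) → 1 ≤ n → 1 ≤ s → s ≤ n →
    (M : Fin (n ∸ s) → Fin n → Carrier F) →
    HasNonzeroPermMinor F M →
    (size F ^ s ∸ 1) * size F ^ n ≤ size F ^ s * goodRowCount F M
lemma2p3 F _ n s _ _ s≤n M hasMinor with ρ , ρ↑ , minor≉0 ← satisfied hasMinor =
  counting-bound (size F) n s (goodRowCount F M) (length badRows) s≤n
                 goodRowCount+length-badRows length-badRows
  where open BadRows F M ρ ρ↑ minor≉0
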